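{- For every $\varepsilon$ with $0<\varepsilon<1/2$ such that $\varepsilon^{ -1}$ is not an integer, there is a cograph $G$ such that there is no partition of $V(G)$ into at most $1/\varepsilon$ sets each of which is $\varepsilon$-restricted.
   Context: All graphs are finite and simple; $G[X]$ is the induced subgraph on $X$, $\overline{G}$ the complement. A cograph is a graph with no induced subgraph isomorphic to $P_4$ (the path on four vertices). For $\varepsilon>0$, a set $X\subseteq V(G)$ is $\varepsilon$-restricted if one of $G[X]$, $\overline{G}[X]$ has maximum degree at most $\varepsilon|X|$.
   Formalization: The parameter ε ranges over the rationals. -}

module Defs where

open import Data.Nat as ℕ using (ℕ; zero; suc)
open import Data.Bool using (Bool; true; false; _∧_; not; if_then_else_)
open import Data.Fin using (Fin; zero; suc; _≟_)
open import Data.Integer using (+_)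
open import Data.Rational using (ℚ; _/_; _*_; _≤_; 1ℚ)
open import Data.Product using (Σ; _×_)
open import Data.Sum using (_⊎_)
open import Relation.Nullary using (¬_)
open import Relation.Nullary.Decidable using (⌊_⌋)
open import Relation.Binary.PropositionalEquality using (_≡_; _≢_)

record Graph (n : ℕ) : Set where
  field
    adj    : Fin n → Fin n → Bool
    adj-sym    : ∀ u v → adj u v ≡ adj v u
    adj-irrefl : ∀ v → adj v v ≡ false
open Graph public

compl : ∀ {n} → Graph n → Graph n
compl G = record
  { adj    = λ u v → not ⌊ u ≟ v ⌋ ∧ not (adj G u v)
  ; adj-sym    = λ u v → lemma u v
  ; adj-irrefl = λ v → irr v
  }
  where
  open import Relation.Binary.PropositionalEquality using (refl; cong₂; sym)
  open import Relation.Nullary using (yes; no)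
  lemma : ∀ u v → (not ⌊ u ≟ v ⌋ ∧ not (adj G u v)) ≡ (not ⌊ v ≟ u ⌋ ∧ not (adj G v u))
  lemma u v with u ≟ v | v ≟ u
  ... | yes _ | yes _ = refl
  ... | no _  | no _  rewrite Graph.adj-sym G u v = refl
  ... | yes p | no q  = Data.Empty.⊥-elim (q (sym p))
    where import Data.Empty
  ... | no p  | yes q = Data.Empty.⊥-elim (p (sym q))
    where import Data.Empty
  irr : ∀ v → (not ⌊ v ≟ v ⌋ ∧ not (adj G v v)) ≡ false
  irr v with v ≟ v
  ... | yes _ = refl
  ... | no p  = Data.Empty.⊥-elim (p refl)
    where import Data.Empty

count : ∀ {n} → (Fin n → Bool) → ℕ
count {zero}  P = 0
count {suc n} P = (if P zero then 1 else 0) ℕ.+ count (λ i → P (suc i))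

record InducedP4 {n} (G : Graph n) : Set where
  field
    a b c d : Fin n
    a≢b : a ≢ b
    a≢c : a ≢ c
    a≢d : a ≢ d
    b≢c : b ≢ c
    b≢d : b ≢ d
    c≢d : c ≢ d
    ab : adj G a b ≡ true
    bc : adj G b c ≡ true
    cd : adj G c d ≡ true
    ac : adj G a c ≡ false
    bd : adj G b d ≡ false
    ad : adj G a d ≡ false

Cograph : ∀ {n} → Graph n → Set
Cograph G = ¬ InducedP4 G

VSet : ℕ → Set
VSet n = Fin n → Bool

size : ∀ {n} → VSet n → ℕ
size X = count X

degIn : ∀ {n} → Graph n → VSet n → Fin n → ℕ
degIn G X v = count (λ w → X w ∧ adj G v w)

toℚ : ℕ → ℚ
toℚ m = + m / 1

MaxDegAtMost : ∀ {n} → Graph n → VSet n → ℚ → Set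
MaxDegAtMost G X ε = ∀ v → X v ≡ true → toℚ (degIn G X v) ≤ ε * toℚ (size X)

Restricted : ∀ {n} → ℚ → Graph n → VSet n → Set
Restricted ε G X = MaxDegAtMost G X ε ⊎ MaxDegAtMost (compl G) X ε

-- A partition of V(G) into k (possibly empty) labelled parts, given by a
-- part-assignment f; part i is {v | f v = i}.
part : ∀ {n k} → (Fin n → Fin k) → Fin k → VSet n
part f i v = ⌊ f v ≟ i ⌋

-- V(G) has a partition into at most k sets, each ε-restricted.
-- (Empty parts are harmless: the empty set is trivially ε-restricted.)
-- V(G) has a partition into at most 1/ε sets each ε-restricted:
-- some k with k ≤ 1/ε (stated as k·ε ≤ 1, ε > 0) and an assignment of
-- vertices to k parts, every part ε-restricted.
HasRestrictedPartition : ∀ {n} → ℚ → Graph n → Set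
HasRestrictedPartition {n} ε G =
  Σ ℕ λ k → (toℚ k * ε ≤ 1ℚ) × Σ (Fin n → Fin k) λ f → ∀ i → Restricted ε G (part f i)

{-# OPTIONS --safe #-}
-- Write ε = p/q. The graph is a disjoint union of cliques L₀, L₁, …, L_{q-1} with
-- |L_j| > q² + p·|L_{j+1} ∪ L_{j+2} ∪ ⋯|, hence a cograph. An ε-restricted set X has at most
-- 1 + ε|X| vertices in a clique that misses some vertex b of X: if X is sparse they form a
-- clique of G[X], if X is dense they are non-neighbours of b. A partition into k ≤ 1/ε parts
-- has k < 1/ε since 1/ε ∉ ℕ, so (j+1)p < q for j < k. Then a part X reaching below L_j has
-- at most (j+1)(1 + ε|X|) vertices in L₀ ∪ ⋯ ∪ L_j, which bounds |X| and in turn gives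
-- |X ∩ L_j| ≤ q + p|X ∩ (L_{j+1} ∪ ⋯)|. If no part had its lowest vertex in L_j, summing this
-- over the parts would give less than |L_j|. So for each j < k some part ends in L_j, and
-- these k parts together with the part of a vertex in L_k would be k + 1 distinct parts.
module Submission where

open import Data.Bool using (Bool; true; false; _∧_; not; if_then_else_)
open import Data.Bool.Properties using (∧-conicalˡ; ∧-conicalʳ; ∧-zeroʳ; ∧-identityʳ; ∧-assoc)
open import Data.Empty using (⊥)
open import Data.Fin using (Fin; zero; suc; toℕ; _≟_; _↑ˡ_; _↑ʳ_; splitAt)
open import Data.Fin.Properties using (any?; pigeonhole; toℕ<n; splitAt-↑ˡ; splitAt-↑ʳ)
import Data.Integer as ℤ
import Data.Integer.Properties as ℤₚ
open import Data.Nat as ℕ using (ℕ; zero; suc; _+_; _*_; _≤_; _<_; z≤n; s≤s; _≤?_; _<?_)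
import Data.Nat.Properties as ℕₚ
open import Algebra.Properties.Semiring.Sum ℕₚ.+-*-semiring
  using (sum; sum-cong-≗; ∑-comm; ∑-distrib-+; *-distribˡ-sum; sum-replicate-zero)
open import Data.Nat.Coprimality using (Coprime)
open import Data.Nat.Tactic.RingSolver using (solve-∀)
open import Data.Product using (Σ; _×_; _,_; proj₁; proj₂)
open import Data.Rational as ℚ using (ℚ; mkℚ; toℚᵘ; 0ℚ; ½; 1ℚ)
open import Data.Rational.Properties using (toℚᵘ-fromℚᵘ; toℚᵘ-mono-≤; toℚᵘ-homo-*; toℚᵘ-injective)
open import Data.Rational.Unnormalised as ℚᵘ using (mkℚᵘ; *≤*; *≡*)
import Data.Rational.Unnormalised.Properties as ℚᵘₚ
open import Data.Sum using (_⊎_; inj₁; inj₂; [_,_]′)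
open import Function using (_∘_)
open import Function.Bundles using (_⇔_; mk⇔)
open import Level using (Level)
open import Relation.Binary.Definitions using (DecidableEquality; tri<; tri≈; tri>)
open import Relation.Binary.PropositionalEquality
open import Relation.Nullary using (Dec; yes; no; ¬_; contradiction; _×-dec_; ¬?)
open import Relation.Nullary.Decidable using (⌊_⌋; ⌊⌋-map′; isYes≗does; dec-true; dec-false; does-⇔)

open import Defs

private
  variable
    a : Level
    A B : Set a
    n k : ℕ

⌊⌋-true : (a? : Dec A) → A → ⌊ a? ⌋ ≡ true
⌊⌋-true a? x = trans (isYes≗does a?) (dec-true a? x)

⌊⌋-false : (a? : Dec A) → ¬ A → ⌊ a? ⌋ ≡ false
⌊⌋-false a? ¬x = trans (isYes≗does a?) (dec-false a? ¬x)

⌊⌋-true⁻¹ : (a? : Dec A) → ⌊ a? ⌋ ≡ true → A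
⌊⌋-true⁻¹ (yes x) _ = x

not⌊⌋-true⁻¹ : (a? : Dec A) → not ⌊ a? ⌋ ≡ true → ¬ A
not⌊⌋-true⁻¹ (no ¬x) _ = ¬x

⌊⌋-cong : A ⇔ B → (a? : Dec A) (b? : Dec B) → ⌊ a? ⌋ ≡ ⌊ b? ⌋
⌊⌋-cong A⇔B a? b? = trans (isYes≗does a?) (trans (does-⇔ A⇔B a? b?) (sym (isYes≗does b?)))

⌊≟⌋-sym : (_≟ᴬ_ : DecidableEquality A) (x y : A) → ⌊ x ≟ᴬ y ⌋ ≡ ⌊ y ≟ᴬ x ⌋
⌊≟⌋-sym _≟ᴬ_ x y = ⌊⌋-cong (mk⇔ sym sym) (x ≟ᴬ y) (y ≟ᴬ x)

≤?-∧-suc : ∀ j l → ⌊ j ≤? l ⌋ ∧ ⌊ suc j ≤? l ⌋ ≡ ⌊ suc j ≤? l ⌋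
≤?-∧-suc j l with ℕₚ.<-cmp j l
... | tri< j<l _ _ rewrite ⌊⌋-true (j ≤? l) (ℕₚ.<⇒≤ j<l) = refl
... | tri≈ _ refl _ rewrite ⌊⌋-true (j ≤? j) ℕₚ.≤-refl = refl
... | tri> _ _ l<j
  rewrite ⌊⌋-false (j ≤? l) (ℕₚ.<⇒≱ l<j) | ⌊⌋-false (suc j ≤? l) (ℕₚ.<⇒≱ (ℕₚ.m<n⇒m<1+n l<j)) = refl

≤?-∧-not-suc : ∀ j l → ⌊ j ≤? l ⌋ ∧ not ⌊ suc j ≤? l ⌋ ≡ ⌊ l ℕ.≟ j ⌋
≤?-∧-not-suc j l with ℕₚ.<-cmp j l
... | tri< j<l j≢l _
  rewrite ⌊⌋-true (j ≤? l) (ℕₚ.<⇒≤ j<l) | ⌊⌋-true (suc j ≤? l) j<l | ⌊⌋-false (l ℕ.≟ j) (j≢l ∘ sym) = refl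
... | tri≈ _ refl _
  rewrite ⌊⌋-true (j ≤? j) ℕₚ.≤-refl | ⌊⌋-false (suc j ≤? j) (ℕₚ.n≮n j) | ⌊⌋-true (j ℕ.≟ j) refl = refl
... | tri> _ j≢l l<j
  rewrite ⌊⌋-false (j ≤? l) (ℕₚ.<⇒≱ l<j) | ⌊⌋-false (l ℕ.≟ j) (j≢l ∘ sym) = refl

indicator : Bool → ℕ
indicator b = if b then 1 else 0

infix  4 _⊆_
infixr 7 _∩_

_⊆_ : VSet n → VSet n → Set
X ⊆ Y = ∀ v → X v ≡ true → Y v ≡ true

_∩_ : VSet n → VSet n → VSet n
(X ∩ Y) v = X v ∧ Y v

∩-monoʳ : {X Y Z : VSet n} → Y ⊆ Z → X ∩ Y ⊆ X ∩ Z
∩-monoʳ {X = X} Y⊆Z v XYv = cong₂ _∧_ (∧-conicalˡ (X v) _ XYv) (Y⊆Z v (∧-conicalʳ (X v) _ XYv))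

count≡sum : (P : VSet n) → count P ≡ sum (indicator ∘ P)
count≡sum {zero}  P = refl
count≡sum {suc n} P = cong (indicator (P zero) +_) (count≡sum (P ∘ suc))

count-cong : {P Q : VSet n} → (∀ v → P v ≡ Q v) → count P ≡ count Q
count-cong {P = P} {Q} P≗Q = trans (count≡sum P) (trans (sum-cong-≗ (cong indicator ∘ P≗Q)) (sym (count≡sum Q)))

count-mono : {P Q : VSet n} → P ⊆ Q → count P ≤ count Q
count-mono {zero}          P⊆Q = z≤n
count-mono {suc n} {P} {Q} P⊆Q = ℕₚ.+-mono-≤ head (count-mono (P⊆Q ∘ suc))
  where
  head : indicator (P zero) ≤ indicator (Q zero)
  head with P zero in P₀
  ... | false = z≤n
  ... | true  rewrite P⊆Q zero P₀ = ℕₚ.≤-refl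

count-split : (P Q : VSet n) → count P ≡ count (P ∩ Q) + count (P ∩ (not ∘ Q))
count-split P Q = begin
  count P                                         ≡⟨ count≡sum P ⟩
  sum (indicator ∘ P)                             ≡⟨ sum-cong-≗ (λ v → indicator-split (P v) (Q v)) ⟩
  sum (λ v → indicator (P∧Q v) + indicator (P∧¬Q v))
                                                  ≡⟨ ∑-distrib-+ (indicator ∘ P∧Q) (indicator ∘ P∧¬Q) ⟩
  sum (indicator ∘ P∧Q) + sum (indicator ∘ P∧¬Q)  ≡⟨ cong₂ _+_ (count≡sum P∧Q) (count≡sum P∧¬Q) ⟨
  count P∧Q + count P∧¬Q                          ∎
  where
  open ≡-Reasoning
  P∧Q P∧¬Q : VSet _
  P∧Q  = P ∩ Q
  P∧¬Q = P ∩ (not ∘ Q)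
  indicator-split : ∀ a b → indicator a ≡ indicator (a ∧ b) + indicator (a ∧ not b)
  indicator-split false _     = refl
  indicator-split true  false = refl
  indicator-split true  true  = refl

count-none : count {n} (λ _ → false) ≡ 0
count-none {zero}  = refl
count-none {suc n} = count-none {n}

count-all : count {n} (λ _ → true) ≡ n
count-all {zero}  = refl
count-all {suc n} = cong suc (count-all {n})

count-++ : ∀ m (P : VSet (m + n)) → count P ≡ count (P ∘ (_↑ˡ n)) + count (P ∘ (m ↑ʳ_))
count-++ zero    P = refl
count-++ (suc m) P = trans (cong (indicator (P zero) +_) (count-++ m (P ∘ suc)))
                           (sym (ℕₚ.+-assoc (indicator (P zero)) _ _))

count-singleton : (u : Fin n) → count (λ v → ⌊ u ≟ v ⌋) ≡ 1
count-singleton {suc n} zero    = cong suc (count-none {n})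
count-singleton {suc n} (suc u) = trans (count-cong (λ v → ⌊⌋-map′ _ _ (u ≟ v))) (count-singleton u)

count-pos : (P : VSet n) {v : Fin n} → P v ≡ true → 0 < count P
count-pos {suc n} P {zero}  Pv rewrite Pv = s≤s z≤n
count-pos {suc n} P {suc v} Pv = ℕₚ.<-≤-trans (count-pos (P ∘ suc) Pv) (ℕₚ.m≤n+m _ (indicator (P zero)))

count-witness : (P : VSet n) → 0 < count P → Σ (Fin n) λ v → P v ≡ true
count-witness {suc n} P 0<c with P zero in P₀
... | true  = zero , P₀
... | false = let v , Pv = count-witness (P ∘ suc) 0<c in suc v , Pv

sum-mono : {f g : Fin k → ℕ} → (∀ i → f i ≤ g i) → sum f ≤ sum g
sum-mono {zero}  f≤g = z≤n
sum-mono {suc k} f≤g = ℕₚ.+-mono-≤ (f≤g zero) (sum-mono (f≤g ∘ suc))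

sum-const : ∀ k c → sum {k} (λ _ → c) ≡ k * c
sum-const zero    c = refl
sum-const (suc k) c = cong (c +_) (sum-const k c)

count-fibres : {k : ℕ} (f : Fin n → Fin k) (P : VSet n) → sum (λ i → count (part f i ∩ P)) ≡ count P
count-fibres {k = k} f P = begin
  sum (λ i → count (part f i ∩ P))                         ≡⟨ sum-cong-≗ (λ i → count≡sum (part f i ∩ P)) ⟩
  sum (λ i → sum (λ v → indicator (⌊ f v ≟ i ⌋ ∧ P v)))    ≡⟨ ∑-comm (λ i v → indicator (⌊ f v ≟ i ⌋ ∧ P v)) ⟩
  sum (λ v → sum (λ i → indicator (⌊ f v ≟ i ⌋ ∧ P v)))    ≡⟨ sum-cong-≗ (λ v → fibre (f v) (P v)) ⟩
  sum (indicator ∘ P)                                      ≡⟨ count≡sum P ⟨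
  count P                                                  ∎
  where
  open ≡-Reasoning
  fibre : (x : Fin k) (b : Bool) → sum (λ i → indicator (⌊ x ≟ i ⌋ ∧ b)) ≡ indicator b
  fibre x false = trans (sum-cong-≗ (λ i → cong indicator (∧-zeroʳ ⌊ x ≟ i ⌋))) (sum-replicate-zero k)
  fibre x true  = trans (sum-cong-≗ (λ i → cong indicator (∧-identityʳ ⌊ x ≟ i ⌋)))
                        (trans (sym (count≡sum (λ i → ⌊ x ≟ i ⌋))) (count-singleton x))

MaxDegAtMostFrac : Graph n → VSet n → ℕ → ℕ → Set
MaxDegAtMostFrac G X p q = ∀ v → X v ≡ true → degIn G X v * q ≤ p * size X

RestrictedFrac : ℕ → ℕ → Graph n → VSet n → Set
RestrictedFrac p q G X = MaxDegAtMostFrac G X p q ⊎ MaxDegAtMostFrac (compl G) X p q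

mkℚᵘ-≤⇒ : ∀ {m n d e} → mkℚᵘ (ℤ.+ m) d ℚᵘ.≤ mkℚᵘ (ℤ.+ n) e → m * suc e ≤ n * suc d
mkℚᵘ-≤⇒ {m} {n} {d} {e} (*≤* le) =
  ℤₚ.drop‿+≤+ (subst₂ ℤ._≤_ (sym (ℤₚ.pos-* m (suc e))) (sym (ℤₚ.pos-* n (suc d))) le)

mkℚᵘ-≃⇐ : ∀ {m n d e} → m * suc e ≡ n * suc d → mkℚᵘ (ℤ.+ m) d ℚᵘ.≃ mkℚᵘ (ℤ.+ n) e
mkℚᵘ-≃⇐ {m} {n} {d} {e} eq = *≡* (trans (sym (ℤₚ.pos-* m (suc e))) (trans (cong ℤ.+_ eq) (ℤₚ.pos-* n (suc d))))

toℚᵘ-toℚ : ∀ a → toℚᵘ (toℚ a) ℚᵘ.≃ mkℚᵘ (ℤ.+ a) 0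
toℚᵘ-toℚ a = toℚᵘ-fromℚᵘ (mkℚᵘ (ℤ.+ a) 0)

module Fraction {p d : ℕ} .(coprime : Coprime p (suc d)) where

  ε : ℚ
  ε = mkℚ (ℤ.+ p) d coprime

  -- ℚᵘ._*_ leaves the denominators of these products as d + 0 and d * 1.
  toℚ*ε≃ : ∀ a → toℚᵘ (toℚ a ℚ.* ε) ℚᵘ.≃ mkℚᵘ (ℤ.+ (a * p)) d
  toℚ*ε≃ a = ℚᵘₚ.≃-trans (toℚᵘ-homo-* (toℚ a) ε) (ℚᵘₚ.≃-trans (ℚᵘₚ.*-congʳ (toℚᵘ-toℚ a))
               (*≡* (cong₂ ℤ._*_ (sym (ℤₚ.pos-* a p)) (cong (λ x → ℤ.+ suc x) (sym (ℕₚ.+-identityʳ d))))))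

  ε*toℚ≃ : ∀ b → toℚᵘ (ε ℚ.* toℚ b) ℚᵘ.≃ mkℚᵘ (ℤ.+ (p * b)) d
  ε*toℚ≃ b = ℚᵘₚ.≃-trans (toℚᵘ-homo-* ε (toℚ b)) (ℚᵘₚ.≃-trans (ℚᵘₚ.*-congˡ (toℚᵘ-toℚ b))
               (*≡* (cong₂ ℤ._*_ (sym (ℤₚ.pos-* p b)) (cong (λ x → ℤ.+ suc x) (sym (ℕₚ.*-identityʳ d))))))

  toℚ≤ε*toℚ⇒ : ∀ a b → toℚ a ℚ.≤ ε ℚ.* toℚ b → a * suc d ≤ p * b
  toℚ≤ε*toℚ⇒ a b a≤εb = subst (a * suc d ≤_) (ℕₚ.*-identityʳ (p * b)) (mkℚᵘ-≤⇒ (begin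
    mkℚᵘ (ℤ.+ a) 0          ≃⟨ toℚᵘ-toℚ a ⟨
    toℚᵘ (toℚ a)            ≤⟨ toℚᵘ-mono-≤ a≤εb ⟩
    toℚᵘ (ε ℚ.* toℚ b)      ≃⟨ ε*toℚ≃ b ⟩
    mkℚᵘ (ℤ.+ (p * b)) d    ∎))
    where open ℚᵘₚ.≤-Reasoning

  toℚ*ε≤1⇒ : ∀ k → toℚ k ℚ.* ε ℚ.≤ 1ℚ → k * p ≤ suc d
  toℚ*ε≤1⇒ k kε≤1 = subst₂ _≤_ (ℕₚ.*-identityʳ (k * p)) (ℕₚ.+-identityʳ (suc d)) (mkℚᵘ-≤⇒ (begin
    mkℚᵘ (ℤ.+ (k * p)) d    ≃⟨ toℚ*ε≃ k ⟨
    toℚᵘ (toℚ k ℚ.* ε)      ≤⟨ toℚᵘ-mono-≤ kε≤1 ⟩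
    mkℚᵘ (ℤ.+ 1) 0          ∎))
    where open ℚᵘₚ.≤-Reasoning

  toℚ*ε≡1 : ∀ k → k * p ≡ suc d → toℚ k ℚ.* ε ≡ 1ℚ
  toℚ*ε≡1 k kp≡q = toℚᵘ-injective (ℚᵘₚ.≃-trans (toℚ*ε≃ k)
    (mkℚᵘ-≃⇐ (trans (ℕₚ.*-identityʳ (k * p)) (trans kp≡q (sym (ℕₚ.+-identityʳ (suc d)))))))

  restricted⇒restrictedFrac : {G : Graph n} {X : VSet n} → Restricted ε G X → RestrictedFrac p (suc d) G X
  restricted⇒restrictedFrac {G = G} {X} (inj₁ sparse) =
    inj₁ λ v Xv → toℚ≤ε*toℚ⇒ (degIn G X v) (size X) (sparse v Xv)
  restricted⇒restrictedFrac {G = G} {X} (inj₂ dense)  =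
    inj₂ λ v Xv → toℚ≤ε*toℚ⇒ (degIn (compl G) X v) (size X) (dense v Xv)

IsClique : Graph n → VSet n → Set
IsClique G S = ∀ {u w} → S u ≡ true → S w ≡ true → u ≢ w → adj G u w ≡ true

clique-size≤1+degree : {G : Graph n} {X S : VSet n} → S ⊆ X → IsClique G S →
                       ∀ {u} → S u ≡ true → size S ≤ suc (degIn G X u)
clique-size≤1+degree {G = G} {X} {S} S⊆X clique {u} Su = begin
  size S                                        ≡⟨ count-split S is-u ⟩
  size (S ∩ is-u) + size (S ∩ (not ∘ is-u))     ≤⟨ ℕₚ.+-mono-≤ (count-mono {P = S ∩ is-u} λ w → ∧-conicalʳ (S w) _)
                                                               (count-mono neighbour) ⟩
  count is-u + degIn G X u                      ≡⟨ cong (_+ degIn G X u) (count-singleton u) ⟩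
  suc (degIn G X u)                             ∎
  where
  open ℕₚ.≤-Reasoning
  is-u : VSet _
  is-u w = ⌊ u ≟ w ⌋
  neighbour : S ∩ (not ∘ is-u) ⊆ (λ w → X w ∧ adj G u w)
  neighbour w Sw∧u≢w = cong₂ _∧_ (S⊆X w Sw) (clique Su Sw (not⌊⌋-true⁻¹ (u ≟ w) (∧-conicalʳ _ _ Sw∧u≢w)))
    where Sw = ∧-conicalˡ _ _ Sw∧u≢w

clique-in-sparse : {G : Graph n} {X S : VSet n} {p q : ℕ} → MaxDegAtMostFrac G X p q → S ⊆ X → IsClique G S →
                   size S * q ≤ q + p * size X
clique-in-sparse {S = S} {q = q} sparse S⊆X clique with 0 <? size S
... | no  S-empty = ℕₚ.≤-trans (ℕₚ.*-monoˡ-≤ q (ℕₚ.≮⇒≥ S-empty)) z≤n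
clique-in-sparse {G = G} {X} {S} {p} {q} sparse S⊆X clique | yes S-nonempty = begin
  size S * q             ≤⟨ ℕₚ.*-monoˡ-≤ q (clique-size≤1+degree {G = G} S⊆X clique Su) ⟩
  suc (degIn G X u) * q  ≤⟨ ℕₚ.+-monoʳ-≤ q (sparse u (S⊆X u Su)) ⟩
  q + p * size X         ∎
  where
  open ℕₚ.≤-Reasoning
  u  = proj₁ (count-witness S S-nonempty)
  Su = proj₂ (count-witness S S-nonempty)

cliqueUnion : DecidableEquality A → (Fin n → A) → Graph n
cliqueUnion _≟ᴬ_ layer = record
  { adj        = λ u v → not ⌊ u ≟ v ⌋ ∧ ⌊ layer u ≟ᴬ layer v ⌋
  ; adj-sym    = λ u v → cong₂ (λ x y → not x ∧ y) (⌊≟⌋-sym _≟_ u v) (⌊≟⌋-sym _≟ᴬ_ (layer u) (layer v))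
  ; adj-irrefl = λ v → cong (λ x → not x ∧ ⌊ layer v ≟ᴬ layer v ⌋) (⌊⌋-true (v ≟ v) refl)
  }

module CliqueUnion {a} {A : Set a} (_≟ᴬ_ : DecidableEquality A) {n} (layer : Fin n → A) where

  G : Graph n
  G = cliqueUnion _≟ᴬ_ layer

  class : A → VSet n
  class x v = ⌊ layer v ≟ᴬ x ⌋

  class⁻¹ : ∀ {x v} → class x v ≡ true → layer v ≡ x
  class⁻¹ {x} {v} = ⌊⌋-true⁻¹ (layer v ≟ᴬ x)

  adj-same : ∀ {u v} → u ≢ v → layer u ≡ layer v → adj G u v ≡ true
  adj-same {u} {v} u≢v same = cong₂ (λ x y → not x ∧ y) (⌊⌋-false (u ≟ v) u≢v) (⌊⌋-true (layer u ≟ᴬ layer v) same)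

  adj-same⁻¹ : ∀ {u v} → adj G u v ≡ true → layer u ≡ layer v
  adj-same⁻¹ {u} {v} uv = ⌊⌋-true⁻¹ (layer u ≟ᴬ layer v) (∧-conicalʳ _ _ uv)

  adj-different : ∀ {u v} → layer u ≢ layer v → adj G u v ≡ false
  adj-different {u} {v} different =
    trans (cong (not ⌊ u ≟ v ⌋ ∧_) (⌊⌋-false (layer u ≟ᴬ layer v) different)) (∧-zeroʳ _)

  cograph : Cograph G
  cograph P = contradiction (trans (sym (adj-same a≢c (trans (adj-same⁻¹ ab) (adj-same⁻¹ bc)))) ac) λ ()
    where open InducedP4 P

  ∩-class-isClique : ∀ X x → IsClique G (X ∩ class x)
  ∩-class-isClique X x {u} {w} Su Sw u≢w =
    adj-same u≢w (trans (class⁻¹ (∧-conicalʳ (X u) _ Su)) (sym (class⁻¹ (∧-conicalʳ (X w) _ Sw))))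

  restricted-∩-class-bound : ∀ {p q X b x} → RestrictedFrac p q G X → X b ≡ true → layer b ≢ x →
                             size (X ∩ class x) * q ≤ q + p * size X
  restricted-∩-class-bound {p} {q} {X} {x = x} (inj₁ sparse) _ _ =
    clique-in-sparse {G = G} {X} {p = p} {q} sparse (λ v → ∧-conicalˡ (X v) _) (∩-class-isClique X x)
  restricted-∩-class-bound {p} {q} {X} {b} {x} (inj₂ dense) Xb b∉x = begin
    size (X ∩ class x) * q   ≤⟨ ℕₚ.*-monoˡ-≤ q (count-mono non-neighbour) ⟩
    degIn (compl G) X b * q  ≤⟨ dense b Xb ⟩
    p * size X               ≤⟨ ℕₚ.m≤n+m (p * size X) q ⟩
    q + p * size X           ∎
    where
    open ℕₚ.≤-Reasoning
    non-neighbour : X ∩ class x ⊆ (λ w → X w ∧ adj (compl G) b w)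
    non-neighbour w Xw∧w∈x = cong₂ _∧_ (∧-conicalˡ (X w) _ Xw∧w∈x)
      (cong₂ (λ y z → not y ∧ not z) (⌊⌋-false (b ≟ w) λ { refl → b∉x w∈x })
                                     (adj-different λ bw → b∉x (trans bw w∈x)))
      where w∈x = class⁻¹ (∧-conicalʳ (X w) _ Xw∧w∈x)

module Layered {n} (layer : Fin n → ℕ) where

  open CliqueUnion ℕ._≟_ layer public

  V : ℕ → VSet n
  V j v = ⌊ j ≤? layer v ⌋

  V-anti : ∀ {i j} → i ≤ j → V j ⊆ V i
  V-anti {i} {j} i≤j v j≤l = ⌊⌋-true (i ≤? layer v) (ℕₚ.≤-trans i≤j (⌊⌋-true⁻¹ (j ≤? layer v) j≤l))

  class⊆V : ∀ j → class j ⊆ V j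
  class⊆V j v l≡j = ⌊⌋-true (j ≤? layer v) (ℕₚ.≤-reflexive (sym (class⁻¹ l≡j)))

  size-∩-V-zero : ∀ X → size (X ∩ V 0) ≡ size X
  size-∩-V-zero X = count-cong λ v → ∧-identityʳ (X v)

  size-∩-V : ∀ X j → size (X ∩ V j) ≡ size (X ∩ class j) + size (X ∩ V (suc j))
  size-∩-V X j = begin
    size Y                                          ≡⟨ count-split Y (V (suc j)) ⟩
    size (Y ∩ V (suc j)) + size (Y ∩ (not ∘ V (suc j)))
                                                    ≡⟨ ℕₚ.+-comm (size (Y ∩ V (suc j))) _ ⟩
    size (Y ∩ (not ∘ V (suc j))) + size (Y ∩ V (suc j))
                                                    ≡⟨ cong₂ _+_ (count-cong in-class) (count-cong below) ⟩
    size (X ∩ class j) + size (X ∩ V (suc j))       ∎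
    where
    open ≡-Reasoning
    Y = X ∩ V j
    in-class : ∀ v → Y v ∧ not (V (suc j) v) ≡ X v ∧ class j v
    in-class v = trans (∧-assoc (X v) _ _) (cong (X v ∧_) (≤?-∧-not-suc j (layer v)))
    below : ∀ v → Y v ∧ V (suc j) v ≡ X v ∧ V (suc j) v
    below v = trans (∧-assoc (X v) _ _) (cong (X v ∧_) (≤?-∧-suc j (layer v)))

  module _ {p q} {X : VSet n} (restricted : RestrictedFrac p q G X) {w} (Xw : X w ≡ true) where

    restricted-size-bound : ∀ m → m ≤ layer w → q * size X ≤ m * (q + p * size X) + q * size (X ∩ V m)
    restricted-size-bound zero    _   = ℕₚ.≤-reflexive (cong (q *_) (sym (size-∩-V-zero X)))
    restricted-size-bound (suc m) m<w = begin
      q * size X                  ≤⟨ restricted-size-bound m (ℕₚ.<⇒≤ m<w) ⟩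
      m * b + q * size (X ∩ V m)  ≡⟨ cong (λ t → m * b + q * t) (size-∩-V X m) ⟩
      m * b + q * (c + r)         ≡⟨ regroup m b q c r ⟩
      m * b + c * q + q * r       ≤⟨ ℕₚ.+-monoˡ-≤ (q * r) (ℕₚ.+-monoʳ-≤ (m * b) c*q≤b) ⟩
      m * b + b + q * r           ≡⟨ cong (_+ q * r) (ℕₚ.+-comm (m * b) b) ⟩
      suc m * b + q * r           ∎
      where
      open ℕₚ.≤-Reasoning
      b = q + p * size X
      c = size (X ∩ class m)
      r = size (X ∩ V (suc m))
      c*q≤b : c * q ≤ b
      c*q≤b = restricted-∩-class-bound {p = p} restricted Xw (ℕₚ.>⇒≢ m<w)
      regroup : ∀ m b q c r → m * b + q * (c + r) ≡ m * b + c * q + q * r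
      regroup = solve-∀

    restricted-∩-layer-bound : ∀ j → suc (suc j * p) ≤ q → suc j ≤ layer w →
                               size (X ∩ class j) ≤ q + p * size (X ∩ V (suc j))
    restricted-∩-layer-bound j ep<q j<w = ℕₚ.≤-trans c≤ (ℕₚ.+-monoˡ-≤ (p * r) ep<q)
      where
      open ℕₚ.≤-Reasoning
      e = suc j
      s = size X
      c = size (X ∩ class j)
      r = size (X ∩ V e)
      identity₁ : ∀ e p s → e * p * s + s ≡ suc (e * p) * s
      identity₁ = solve-∀
      identity₂ : ∀ e p s q r → e * (q + p * s) + q * r ≡ e * p * s + (e * q + q * r)
      identity₂ = solve-∀
      identity₃ : ∀ e p q r → q + p * (e * q + q * r) ≡ (suc (e * p) + p * r) * q
      identity₃ = solve-∀
      instance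
        q≢0 : ℕ.NonZero q
        q≢0 = ℕ.>-nonZero (ℕₚ.<-≤-trans (s≤s z≤n) ep<q)
      s≤ : s ≤ e * q + q * r
      s≤ = ℕₚ.+-cancelˡ-≤ (e * p * s) s _ (begin
        e * p * s + s                ≡⟨ identity₁ e p s ⟩
        suc (e * p) * s              ≤⟨ ℕₚ.*-monoˡ-≤ s ep<q ⟩
        q * s                        ≤⟨ restricted-size-bound e j<w ⟩
        e * (q + p * s) + q * r      ≡⟨ identity₂ e p s q r ⟩
        e * p * s + (e * q + q * r)  ∎)
      c≤ : c ≤ suc (e * p) + p * r
      c≤ = ℕₚ.*-cancelʳ-≤ c _ q (begin
        c * q                        ≤⟨ restricted-∩-class-bound {p = p} restricted Xw (ℕₚ.>⇒≢ j<w) ⟩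
        q + p * s                    ≤⟨ ℕₚ.+-monoʳ-≤ q (ℕₚ.*-monoʳ-≤ p s≤) ⟩
        q + p * (e * q + q * r)      ≡⟨ identity₃ e p q r ⟩
        (suc (e * p) + p * r) * q    ∎)

  module Partition {p q k} (kp<q : suc (k * p) ≤ q)
                   (growth : ∀ j → j ≤ k → k * q + suc p * size (V (suc j)) < size (V j))
                   (f : Fin n → Fin k) (restricted : ∀ i → RestrictedFrac p q G (part f i)) where

    Reaches : Fin k → ℕ → Set
    Reaches i j = 0 < size (part f i ∩ V j)

    reaches-anti : ∀ {i j j′} → j ≤ j′ → Reaches i j′ → Reaches i j
    reaches-anti j≤j′ reach = ℕₚ.<-≤-trans reach (count-mono (∩-monoʳ (V-anti j≤j′)))

    part-∩-layer-bound : ∀ j → j < k → ∀ i → Reaches i (suc j) →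
                         size (part f i ∩ class j) ≤ q + p * size (part f i ∩ V (suc j))
    part-∩-layer-bound j j<k i reach =
      restricted-∩-layer-bound (restricted i) (∧-conicalˡ _ _ Xw∧Vw) j ep<q
        (⌊⌋-true⁻¹ (suc j ≤? layer w) (∧-conicalʳ _ _ Xw∧Vw))
      where
      w     = proj₁ (count-witness (part f i ∩ V (suc j)) reach)
      Xw∧Vw = proj₂ (count-witness (part f i ∩ V (suc j)) reach)
      ep<q : suc (suc j * p) ≤ q
      ep<q = ℕₚ.≤-trans (s≤s (ℕₚ.*-monoˡ-≤ p j<k)) kp<q

    part-ending-at : ∀ j → j < k → Σ (Fin k) λ i → Reaches i j × ¬ Reaches i (suc j)
    part-ending-at j j<k
      with any? (λ i → (0 <? size (part f i ∩ class j)) ×-dec ¬? (0 <? size (part f i ∩ V (suc j))))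
    ... | yes (i , meets , ¬reach) = i , ℕₚ.<-≤-trans meets (count-mono (∩-monoʳ (class⊆V j))) , ¬reach
    ... | no none = contradiction (growth j (ℕₚ.<⇒≤ j<k)) (ℕₚ.≤⇒≯ V-small)
      where
      open ℕₚ.≤-Reasoning
      r = size (V (suc j))
      in-class below : Fin k → ℕ
      in-class i = size (part f i ∩ class j)
      below    i = size (part f i ∩ V (suc j))
      bound : ∀ i → in-class i ≤ q + p * below i
      bound i with 0 <? below i
      ... | yes reach = part-∩-layer-bound j j<k i reach
      ... | no ¬reach = ℕₚ.≤-trans (ℕₚ.≮⇒≥ (λ meets → none (i , meets , ¬reach))) z≤n
      regroup : ∀ a p r → a + p * r + r ≡ a + suc p * r
      regroup = solve-∀
      V-small : size (V j) ≤ k * q + suc p * r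
      V-small = begin
        size (V j)                                       ≡⟨ size-∩-V (λ _ → true) j ⟩
        size (class j) + r                               ≡⟨ cong (_+ r) (count-fibres f (class j)) ⟨
        sum in-class + r                                 ≤⟨ ℕₚ.+-monoˡ-≤ r (sum-mono bound) ⟩
        sum (λ i → q + p * below i) + r
          ≡⟨ cong (_+ r) (∑-distrib-+ (λ _ → q) (λ i → p * below i)) ⟩
        sum {k} (λ _ → q) + sum (λ i → p * below i) + r
          ≡⟨ cong₂ (λ x y → x + y + r) (sum-const k q) (sym (*-distribˡ-sum p below)) ⟩
        k * q + p * sum below + r
          ≡⟨ cong (λ x → k * q + p * x + r) (count-fibres f (V (suc j))) ⟩
        k * q + p * r + r                                ≡⟨ regroup (k * q) p r ⟩
        k * q + suc p * r                                ∎

    part-reaching : (j : Fin (suc k)) → Σ (Fin k) λ i → Reaches i (toℕ j) × (toℕ j < k → ¬ Reaches i (suc (toℕ j)))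
    part-reaching j with toℕ j <? k
    ... | yes j<k = let i , reach , ¬reach = part-ending-at (toℕ j) j<k in i , reach , λ _ → ¬reach
    ... | no  j≮k = f w , count-pos (part f (f w) ∩ V (toℕ j)) w∈own-part , λ j<k → contradiction j<k j≮k
      where
      V-k-nonempty : 0 < size (V k)
      V-k-nonempty = ℕₚ.<-≤-trans (s≤s z≤n) (growth k ℕₚ.≤-refl)
      w   = proj₁ (count-witness (V k) V-k-nonempty)
      Vkw = proj₂ (count-witness (V k) V-k-nonempty)
      w∈own-part : (part f (f w) ∩ V (toℕ j)) w ≡ true
      w∈own-part = cong₂ _∧_ (⌊⌋-true (f w ≟ f w) refl) (V-anti (ℕₚ.≤-pred (toℕ<n j)) w Vkw)

    impossible : ⊥
    impossible with pigeonhole (ℕₚ.n<1+n k) (proj₁ ∘ part-reaching)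
    ... | j₁ , j₂ , j₁<j₂ , same = proj₂ (proj₂ (part-reaching j₁)) j₁<k (reaches-anti j₁<j₂ reach₂)
      where
      j₁<k = ℕₚ.<-≤-trans j₁<j₂ (ℕₚ.≤-pred (toℕ<n j₂))
      reach₂ = subst (λ i → Reaches i (toℕ j₂)) (sym same) (proj₁ (proj₂ (part-reaching j₂)))

  no-restricted-partition : ∀ {p q k} → suc (k * p) ≤ q →
                            (∀ j → j ≤ k → k * q + suc p * size (V (suc j)) < size (V j)) →
                            (f : Fin n → Fin k) → ¬ (∀ i → RestrictedFrac p q G (part f i))
  no-restricted-partition kp<q growth f restricted = Partition.impossible kp<q growth f restricted

module Tower (p q : ℕ) where

  open Layered using (V)

  layerAbove : ℕ → ℕ
  layerAbove m = suc (q * q + p * m)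

  towerSize : ℕ → ℕ
  towerSize zero    = 0
  towerSize (suc c) = layerAbove (towerSize c) + towerSize c

  towerLayer : (c : ℕ) → Fin (towerSize c) → ℕ
  towerLayer (suc c) v = [ (λ _ → 0) , suc ∘ towerLayer c ]′ (splitAt (layerAbove (towerSize c)) v)

  size-V-zero : ∀ c → size (V (towerLayer c) 0) ≡ towerSize c
  size-V-zero c = count-all

  size-V-suc : ∀ c j → size (V (towerLayer (suc c)) (suc j)) ≡ size (V (towerLayer c) j)
  size-V-suc c j = begin
    count P                                          ≡⟨ count-++ top P ⟩
    count (P ∘ (_↑ˡ rest)) + count (P ∘ (top ↑ʳ_))  ≡⟨ cong₂ _+_ (trans (count-cong on-top) (count-none {top}))
                                                                  (count-cong below) ⟩
    size (V (towerLayer c) j)                        ∎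
    where
    open ≡-Reasoning
    top  = layerAbove (towerSize c)
    rest = towerSize c
    P = V (towerLayer (suc c)) (suc j)
    on-top : ∀ i → P (i ↑ˡ rest) ≡ false
    on-top i rewrite splitAt-↑ˡ top i rest = refl
    below : ∀ v → P (top ↑ʳ v) ≡ V (towerLayer c) j v
    below v rewrite splitAt-↑ʳ top rest v = ⌊⌋-cong (mk⇔ ℕₚ.≤-pred s≤s) _ _

  tower-growth : ∀ {k} → k ≤ q → ∀ c j → j < c →
                 k * q + suc p * size (V (towerLayer c) (suc j)) < size (V (towerLayer c) j)
  tower-growth {k} k≤q (suc c) zero _
    rewrite size-V-suc c 0 | size-V-zero c | size-V-zero (suc c) = begin-strict
      k * q + suc p * t   ≤⟨ ℕₚ.+-monoˡ-≤ (suc p * t) (ℕₚ.*-monoˡ-≤ q k≤q) ⟩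
      q * q + suc p * t   ≡⟨ regroup (q * q) p t ⟩
      q * q + p * t + t   <⟨ ℕₚ.n<1+n _ ⟩
      layerAbove t + t    ∎
    where
    open ℕₚ.≤-Reasoning
    t = towerSize c
    regroup : ∀ a p t → a + suc p * t ≡ a + p * t + t
    regroup = solve-∀
  tower-growth k≤q (suc c) (suc j) (s≤s j<c)
    rewrite size-V-suc c (suc j) | size-V-suc c j = tower-growth k≤q c j j<c

mainTheorem13 : (ε : ℚ) → 0ℚ ℚ.< ε → ε ℚ.< ½ → ¬ (Σ ℕ λ m → toℚ m ℚ.* ε ≡ 1ℚ) →
    Σ ℕ λ n → Σ (Graph n) λ G → Cograph G × ¬ HasRestrictedPartition ε G
mainTheorem13 (mkℚ (ℤ.+ zero) _ _) (ℚ.*<* (ℤ.+<+ ())) _ _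
mainTheorem13 (mkℚ ℤ.-[1+ _ ] _ _) (ℚ.*<* ()) _ _
mainTheorem13 (mkℚ (ℤ.+ suc p′) d coprime) _ _ no-inverse = towerSize q , G , cograph , no-partition
  where
  p = suc p′
  q = suc d
  open Tower p q
  open Layered (towerLayer q)
  open Fraction coprime
  no-partition : ¬ HasRestrictedPartition ε G
  no-partition (k , kε≤1 , f , restricted) =
    no-restricted-partition kp<q growth f (restricted⇒restrictedFrac {G = G} ∘ restricted)
    where
    kp<q : suc (k * p) ≤ q
    kp<q = ℕₚ.≤∧≢⇒< (toℚ*ε≤1⇒ k kε≤1) (λ kp≡q → no-inverse (k , toℚ*ε≡1 k kp≡q))
    k<q : k < q
    k<q = ℕₚ.≤-<-trans (ℕₚ.m≤m*n k p) kp<q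
    growth : ∀ j → j ≤ k → k * q + suc p * size (V (suc j)) < size (V j)
    growth j j≤k = tower-growth (ℕₚ.<⇒≤ k<q) q j (ℕₚ.≤-<-trans j≤k k<q)
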